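{- For each integer $n\ge1$ let \[ A_n(\mathbf{x})=\sum_{\pi\in \mathrm{RSP}(n)}\ \prod_{j\in\mathrm{DES}(\pi)} x_{n-j} \] (a polynomial in commuting variables $x_1,x_2,\dots$; descents are indexed from the end). Then for all $n\ge1$, \[ A_n(\mathbf{x})=1+\sum_{i=1}^{n-2}\left(\binom{n-1}{i}-1\right)x_iA_i(\mathbf{x}), \] and for all $n\ge 2$, \[ A_n(\mathbf{x})=A_{n-1}(\mathbf{x})+\sum_{i=1}^{n-2}\binom{n-2}{i-1}x_iA_i(\mathbf{x}). \]
   Context: For a permutation $\pi\in S_n$ in one-line notation $\pi(1)\dotsm\pi(n)$, $k\in[n-1]$ is a descent if $\pi(k)>\pi(k+1)$; $\mathrm{DES}(\pi)$ is the set of descents. The runs of $\pi$ are its maximal increasing contiguous subwords (so $\pi$ with $r-1$ descents is the concatenation of $r$ runs). $\mathrm{runsort}(\pi)$ is the permutation obtained by rearranging the runs of $\pi$ in lexicographic order (for permutations: in increasing order of their first entries). $\mathrm{RSP}(n)=\{\mathrm{runsort}(\sigma):\sigma\in S_n\}$, the set of run-sorted permutations of $[n]$ (also called flattened partitions). Empty sums are $0$. -}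

module Defs where

open import Data.Nat using (ℕ; zero; suc; _∸_; _<ᵇ_; _≟_)
open import Data.Bool using (Bool; true; false; if_then_else_)
open import Data.List using (List; []; _∷_; map; concat; concatMap; upTo; length; foldr; deduplicate)
import Data.List.Properties as LP
open import Algebra.Bundles using (CommutativeSemiring)

insertAll : ℕ → List ℕ → List (List ℕ)
insertAll x [] = (x ∷ []) ∷ []
insertAll x (y ∷ ys) = (x ∷ y ∷ ys) ∷ map (y ∷_) (insertAll x ys)

perms : List ℕ → List (List ℕ)
perms [] = [] ∷ []
perms (x ∷ xs) = concatMap (insertAll x) (perms xs)

range1 : ℕ → List ℕ
range1 n = map suc (upTo n)

Sym : ℕ → List (List ℕ)
Sym n = perms (range1 n)

runs : List ℕ → List (List ℕ)
runs [] = []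
runs (a ∷ rest) with runs rest
... | [] = (a ∷ []) ∷ []
... | [] ∷ rs = (a ∷ []) ∷ [] ∷ rs
... | (b ∷ r) ∷ rs = if a <ᵇ b then (a ∷ b ∷ r) ∷ rs else (a ∷ []) ∷ (b ∷ r) ∷ rs

-- first entry of a run (runs are nonempty)
headOr0 : List ℕ → ℕ
headOr0 [] = 0
headOr0 (a ∷ _) = a

-- insertion sort of runs by increasing first entry
-- (for runs of a permutation this is lexicographic order)
insertRun : List ℕ → List (List ℕ) → List (List ℕ)
insertRun r [] = r ∷ []
insertRun r (s ∷ ss) = if headOr0 s <ᵇ headOr0 r then s ∷ insertRun r ss else r ∷ s ∷ ss

sortRuns : List (List ℕ) → List (List ℕ)
sortRuns = foldr insertRun []

runsort : List ℕ → List ℕ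
runsort π = concat (sortRuns (runs π))

RSP : ℕ → List (List ℕ)
RSP n = deduplicate (LP.≡-dec _≟_) (map runsort (Sym n))

-- Descent set DES(π) ⊆ [n-1] (1-indexed positions k with π(k) > π(k+1)).

desFrom : ℕ → List ℕ → List ℕ
desFrom k [] = []
desFrom k (a ∷ []) = []
desFrom k (a ∷ b ∷ rest) =
  if b <ᵇ a then k ∷ desFrom (suc k) (b ∷ rest) else desFrom (suc k) (b ∷ rest)

DES : List ℕ → List ℕ
DES π = desFrom 1 π

-- The polynomial A_n(x), evaluated in an arbitrary commutative semiring
-- at an arbitrary assignment x : ℕ → Carrier of the variables x_1, x_2, ….

module _ {c ℓ} (R : CommutativeSemiring c ℓ) where
  open CommutativeSemiring R

  Σ[_] : List Carrier → Carrier
  Σ[ xs ] = foldr _+_ 0# xs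

  Π[_] : List Carrier → Carrier
  Π[ xs ] = foldr _*_ 1# xs

  _·_ : ℕ → Carrier → Carrier
  zero · a = 0#
  suc k · a = a + (k · a)

  A : (ℕ → Carrier) → ℕ → Carrier
  A x n = Σ[ map (λ π → Π[ map (λ j → x (n ∸ j)) (DES π) ]) (RSP n) ]

  Σ1 : ℕ → (ℕ → Carrier) → Carrier
  Σ1 m f = Σ[ map f (range1 m) ]

-- A run-sorted permutation of an increasing word m T starts with m. Either it is
-- m T itself, or its first run is m K for a nonempty subword K of T and it
-- continues with a run-sorted permutation ρ of the complement S ≠ ∅, where the
-- new run forces min S < max K. The descent between the two parts is followed
-- by the |S| entries of ρ, so it contributes x_|S|, and the weighted sum over
-- such ρ is A_|S| (it only depends on |S|). Among the C(n-1, i) subsets S of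
-- T of size i, the only one violating min S < max K is the set of the i
-- largest entries; this gives the first recurrence. The second follows from
-- the first one by Pascal's rule C(n-1, i) - 1 = (C(n-2, i) - 1) + C(n-2, i-1).

module Submission where

open import Defs
open import Algebra.Bundles using (CommutativeSemiring)
open import Data.Bool using (true; false; if_then_else_)
open import Data.Empty using (⊥-elim)
open import Data.List using (List; []; _∷_; _++_; map; concat; concatMap; length; upTo; drop)
import Data.List.Properties as List
open import Data.List.Membership.Propositional using (_∈_; _∉_; find; lose)
open import Data.List.Membership.Propositional.Properties
  using (∈-map⁺; ∈-map⁻; ∈-++⁺ˡ; ∈-++⁺ʳ; ∈-++⁻; ∈-∃++; ∈-upTo⁻; ∈-concatMap⁺;
         ∈-concatMap⁻; ∈-deduplicate⁺; ∈-deduplicate⁻)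
open import Data.List.Membership.Propositional.Properties.WithK using (unique∧set⇒bag)
open import Data.List.Relation.Binary.BagAndSetEquality using (∼bag⇒↭)
open import Data.List.Relation.Binary.Equality.Propositional using (≋⇒≡)
open import Data.List.Relation.Binary.Permutation.Propositional
  using (_↭_; ↭-refl; ↭-sym; ↭-trans; prep; swap; ↭⇒↭ₛ; ↭⇒↭ₛ′)
open import Data.List.Relation.Binary.Permutation.Propositional.Properties
  using (↭-empty-inv; ∈-resp-↭; ++⁺ˡ; ++⁺ʳ; ++-comm; shift; drop-mid; drop-∷; ↭-length)
  renaming (map⁺ to ↭-map⁺)
import Data.List.Relation.Binary.Permutation.Setoid.Properties as Permutationₛ
open import Data.List.Relation.Unary.All as All using (All; []; _∷_)
import Data.List.Relation.Unary.All.Properties as All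
open import Data.List.Relation.Unary.AllPairs as AllPairs using ([]; _∷_)
open import Data.List.Relation.Unary.Any using (here; there)
open import Data.List.Relation.Unary.Linked as Linked using (Linked; []; [-]; _∷_)
open import Data.List.Relation.Unary.Linked.Properties using (Linked⇒All; Linked⇒AllPairs; applyUpTo⁺₂)
open import Data.List.Relation.Unary.Sorted.TotalOrder.Properties using (↗↭↗⇒≋)
open import Data.List.Relation.Unary.Unique.Propositional using (Unique)
import Data.List.Relation.Unary.Unique.Propositional.Properties as Unique
open import Data.Nat using (ℕ; zero; suc; _+_; _∸_; _≤_; _<_; _<ᵇ_; _≡ᵇ_; z≤n; s≤s; s≤s⁻¹; _≟_; _<?_)
open import Data.List.Relation.Unary.Unique.DecPropositional.Properties (List.≡-dec _≟_)
  using (deduplicate-!)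
open import Data.Nat.Combinatorics using (_C_; nCk+nC[k+1]≡[n+1]C[k+1]; nCn≡1; k>n⇒nCk≡0)
open import Data.Nat.Induction using (<-rec)
open import Data.Nat.Properties
  using (<ᵇ-reflects-<; ≡⇒≡ᵇ; ≡ᵇ⇒≡; ≤-totalOrder; ≤-refl; ≤-reflexive; ≤-trans; ≤-antisym;
         <-trans; <-irrefl; <-asym; <-≤-trans; <-cmp; <⇒≤; <⇒≱; <⇒≢; ≮⇒≥; ≤∧≢⇒<; n<1+n;
         m<n⇒m<1+n; m≤m+n; m∸n≤m; m≢1+n+m; suc-injective; +-assoc; +-comm; +-suc; +-∸-assoc;
         +-∸-comm; m+n∸m≡n)
open import Data.Product using (∃; _×_; _,_; proj₁; proj₂)
open import Data.Sum using (_⊎_; inj₁; inj₂)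
open import Data.Unit using (⊤; tt)
open import Function.Base using (_∘_)
open import Function.Bundles using (mk⇔)
open import Relation.Binary.PropositionalEquality
  using (_≡_; _≢_; refl; sym; trans; cong; cong₂; subst; subst₂; setoid; ≢-sym; module ≡-Reasoning)
open import Relation.Binary.Definitions using (tri<; tri≈; tri>)
open import Relation.Nullary using (¬_; yes; no; ofʸ; ofⁿ)

<ᵇ-true : ∀ {m n} → m < n → (m <ᵇ n) ≡ true
<ᵇ-true {m} {n} m<n with m <ᵇ n | <ᵇ-reflects-< m n
... | true  | _        = refl
... | false | ofⁿ m≮n = ⊥-elim (m≮n m<n)

<ᵇ-false : ∀ {m n} → n ≤ m → (m <ᵇ n) ≡ false
<ᵇ-false {m} {n} n≤m with m <ᵇ n | <ᵇ-reflects-< m n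
... | false | _        = refl
... | true  | ofʸ m<n = ⊥-elim (<⇒≱ m<n n≤m)

∸-offset : ∀ {n} k {m} → suc n ≡ k + suc m → n ∸ k ≡ m
∸-offset {n} k {m} e = trans (cong (_∸ k) (suc-injective (trans e (+-suc k m)))) (m+n∸m≡n k m)

∈-concatMap-∃ : ∀ {A B : Set} (f : A → List B) xs {y} → y ∈ concatMap f xs → ∃ λ a → a ∈ xs × y ∈ f a
∈-concatMap-∃ f xs m = find (∈-concatMap⁻ f m)

∈-concatMap-intro : ∀ {A B : Set} (f : A → List B) {a xs y} → a ∈ xs → y ∈ f a → y ∈ concatMap f xs
∈-concatMap-intro f a∈xs y∈fa = ∈-concatMap⁺ f (lose a∈xs y∈fa)

∈-∷-≢ : ∀ {z t : ℕ} {ts} → z ∈ t ∷ ts → z ≢ t → z ∈ ts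
∈-∷-≢ (here z≡t) z≢t = ⊥-elim (z≢t z≡t)
∈-∷-≢ (there z∈) _   = z∈

++-cancelˡ-↭ : ∀ (K : List ℕ) {xs ys} → K ++ xs ↭ K ++ ys → xs ↭ ys
++-cancelˡ-↭ []      p = p
++-cancelˡ-↭ (c ∷ K) p = ++-cancelˡ-↭ K (drop-∷ p)

unique-++-∉ : ∀ (xs : List ℕ) {ys z} → Unique (xs ++ ys) → z ∈ xs → z ∉ ys
unique-++-∉ (x ∷ xs) (x∉ ∷ _) (here refl) z∈ys = All.lookup x∉ (∈-++⁺ʳ xs z∈ys) refl
unique-++-∉ (x ∷ xs) (_ ∷ u)  (there z∈)  z∈ys = unique-++-∉ xs u z∈ z∈ys

concatMap-unique : ∀ {A B C : Set} (f : A → List B) (key : B → C) (tag : A → C) xs →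
  Unique (map tag xs) → (∀ {a} → a ∈ xs → Unique (f a)) →
  (∀ {a b} → a ∈ xs → b ∈ f a → key b ≡ tag a) → Unique (concatMap f xs)
concatMap-unique f key tag []       _            _        _      = []
concatMap-unique f key tag (a ∷ xs) (a∉ ∷ u-tags) u-blocks keyed =
  Unique.++⁺ (u-blocks (here refl))
    (concatMap-unique f key tag xs u-tags (u-blocks ∘ there) (keyed ∘ there))
    disjoint
  where
  disjoint : ∀ {b} → ¬ (b ∈ f a × b ∈ concatMap f xs)
  disjoint (b∈a , b∈xs) with ∈-concatMap-∃ f xs b∈xs
  ... | a′ , a′∈ , b∈a′ =
    All.lookup a∉ (∈-map⁺ tag a′∈) (trans (sym (keyed (here refl) b∈a)) (keyed (there a′∈) b∈a′))

Increasing : List ℕ → Set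
Increasing = Linked _<_

increasing-head< : ∀ {a l} → Increasing (a ∷ l) → All (a <_) l
increasing-head< [-]         = []
increasing-head< (a<b ∷ inc) = Linked⇒All <-trans a<b inc

increasing-head≤ : ∀ {a l z} → Increasing (a ∷ l) → z ∈ a ∷ l → a ≤ z
increasing-head≤ inc (here refl) = ≤-refl
increasing-head≤ inc (there z∈l) = <⇒≤ (All.lookup (increasing-head< inc) z∈l)

increasing-head∉ : ∀ {a l} → Increasing (a ∷ l) → a ∉ l
increasing-head∉ inc a∈l = <-irrefl refl (All.lookup (increasing-head< inc) a∈l)

increasing⇒unique : ∀ {l} → Increasing l → Unique l
increasing⇒unique inc = AllPairs.map <⇒≢ (Linked⇒AllPairs <-trans inc)

↭-increasing⇒unique : ∀ {xs ys} → xs ↭ ys → Increasing ys → Unique xs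
↭-increasing⇒unique p inc =
  Permutationₛ.Unique-resp-↭ (setoid ℕ) (↭⇒↭ₛ (↭-sym p)) (increasing⇒unique inc)

increasing-↭⇒≡ : ∀ {xs ys} → Increasing xs → Increasing ys → xs ↭ ys → xs ≡ ys
increasing-↭⇒≡ ixs iys p =
  ≋⇒≡ (↗↭↗⇒≋ ≤-totalOrder (Linked.map <⇒≤ ixs) (Linked.map <⇒≤ iys) (↭⇒↭ₛ p))

increasing-range1 : ∀ n → Increasing (range1 n)
increasing-range1 n = subst Increasing (sym (List.map-upTo suc n)) (applyUpTo⁺₂ suc n (λ i → n<1+n (suc i)))

length-range1 : ∀ n → length (range1 n) ≡ n
length-range1 n = trans (List.length-map suc (upTo n)) (List.length-upTo n)

lastOf : ℕ → List ℕ → ℕ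
lastOf a []      = a
lastOf a (b ∷ v) = lastOf b v

lastOf-∈ : ∀ a v → lastOf a v ∈ a ∷ v
lastOf-∈ a []      = here refl
lastOf-∈ a (b ∷ v) = there (lastOf-∈ b v)

-- Runs and run-sorted words

data IsRun : List ℕ → Set where
  run : ∀ {a v} → Increasing (a ∷ v) → IsRun (a ∷ v)

-- After a run ending in c, such a ρ begins a new run.
_≥Head_ : ℕ → List ℕ → Set
c ≥Head []      = ⊤
c ≥Head (b ∷ _) = b ≤ c

runs-∷ : ∀ a L → ∃ λ w → ∃ λ rs → runs (a ∷ L) ≡ (a ∷ w) ∷ rs
runs-∷ a L with runs L
... | []           = [] , [] , refl
... | [] ∷ rs      = [] , [] ∷ rs , refl
... | (b ∷ r) ∷ rs with a <ᵇ b
...   | true  = b ∷ r , rs , refl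
...   | false = [] , (b ∷ r) ∷ rs , refl

concat-runs : ∀ π → concat (runs π) ≡ π
concat-runs [] = refl
concat-runs (a ∷ L) with runs L | concat-runs L
... | []           | e = cong (a ∷_) e
... | [] ∷ rs      | e = cong (a ∷_) e
... | (b ∷ r) ∷ rs | e with a <ᵇ b
...   | true  = cong (a ∷_) e
...   | false = cong (a ∷_) e

runs-isRun : ∀ π → All IsRun (runs π)
runs-isRun [] = []
runs-isRun (a ∷ L) with runs L | runs-isRun L
... | []           | _              = run [-] ∷ []
... | [] ∷ rs      | rs-runs        = run [-] ∷ rs-runs
... | (b ∷ r) ∷ rs | run inc ∷ rs-runs with a <ᵇ b | <ᵇ-reflects-< a b
...   | true  | ofʸ a<b = run (a<b ∷ inc) ∷ rs-runs
...   | false | _       = run [-] ∷ run inc ∷ rs-runs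

runs-++ : ∀ a v ρ → Increasing (a ∷ v) → lastOf a v ≥Head ρ → runs (a ∷ v ++ ρ) ≡ (a ∷ v) ∷ runs ρ
runs-++ a [] [] _ _ = refl
runs-++ a [] (b ∷ ρ) _ b≤a with runs-∷ b ρ
... | w , rs , e rewrite e | <ᵇ-false b≤a = refl
runs-++ a (c ∷ v) ρ (a<c ∷ inc) ρ≤ rewrite runs-++ c v ρ inc ρ≤ | <ᵇ-true a<c = refl

runs-++-merge : ∀ a v L → Increasing (a ∷ v) →
  ∃ λ w → runs (a ∷ v ++ L) ≡ (a ∷ w) ∷ runs L ⊎ runs (a ∷ v ++ L) ≡ (a ∷ w) ∷ drop 1 (runs L)
runs-++-merge a [] L _ with runs L
... | []           = [] , inj₁ refl
... | [] ∷ rs      = [] , inj₁ refl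
... | (b ∷ r) ∷ rs with a <ᵇ b
...   | true  = b ∷ r , inj₂ refl
...   | false = [] , inj₁ refl
runs-++-merge a (c ∷ v) L (a<c ∷ inc) with runs-++-merge c v L inc
... | w , inj₁ e rewrite e | <ᵇ-true a<c = c ∷ w , inj₁ refl
... | w , inj₂ e rewrite e | <ᵇ-true a<c = c ∷ w , inj₂ refl

runs-increasing : ∀ {a v} → Increasing (a ∷ v) → runs (a ∷ v) ≡ (a ∷ v) ∷ []
runs-increasing {a} {v} inc =
  subst (λ u → runs (a ∷ u) ≡ (a ∷ v) ∷ []) (List.++-identityʳ v) (runs-++ a v [] inc tt)

heads : List (List ℕ) → List ℕ
heads = map headOr0

HeadsFrom : ℕ → List (List ℕ) → Set
HeadsFrom b rs = Linked _≤_ (b ∷ heads rs)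

RunSorted : List ℕ → Set
RunSorted π = HeadsFrom 0 (runs π)

headsFrom-lower : ∀ {a b} rs → a ≤ b → HeadsFrom b rs → HeadsFrom a rs
headsFrom-lower []       a≤b [-]           = [-]
headsFrom-lower (r ∷ rs) a≤b (b≤r ∷ sorted) = ≤-trans a≤b b≤r ∷ sorted

headsFrom-tail : ∀ {b} r rs → HeadsFrom b (r ∷ rs) → HeadsFrom (headOr0 r) rs
headsFrom-tail r rs (_ ∷ sorted) = sorted

headsFrom-drop1 : ∀ {b} rs → HeadsFrom b rs → HeadsFrom b (drop 1 rs)
headsFrom-drop1 []       sorted = sorted
headsFrom-drop1 (r ∷ rs) (b≤r ∷ sorted) = headsFrom-lower rs b≤r sorted

runSorted-lower : ∀ {b s ρ} → b ≤ s → RunSorted (s ∷ ρ) → HeadsFrom b (runs (s ∷ ρ))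
runSorted-lower {b} {s} {ρ} b≤s sorted with runs-∷ s ρ
... | w , rs , e rewrite e = b≤s ∷ headsFrom-tail (s ∷ w) rs sorted

runSorted-increasing : ∀ {a v} → Increasing (a ∷ v) → RunSorted (a ∷ v)
runSorted-increasing inc rewrite runs-increasing inc = z≤n ∷ [-]

runSorted-++ : ∀ {a v ρ} → Increasing (a ∷ v) → lastOf a v ≥Head ρ →
  RunSorted (a ∷ v ++ ρ) → HeadsFrom a (runs ρ)
runSorted-++ {a} {v} {ρ} inc ρ≤ sorted rewrite runs-++ a v ρ inc ρ≤ = headsFrom-tail (a ∷ v) (runs ρ) sorted

headsFrom-concat : ∀ {b} rs → All IsRun rs → HeadsFrom b rs → HeadsFrom b (runs (concat rs))
headsFrom-concat [] _ _ = [-]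
headsFrom-concat ((a ∷ v) ∷ rs) (run inc ∷ rs-runs) (b≤a ∷ sorted)
  with runs-++-merge a v (concat rs) inc | headsFrom-concat rs rs-runs sorted
... | w , inj₁ e | ih rewrite e = b≤a ∷ ih
... | w , inj₂ e | ih rewrite e = b≤a ∷ headsFrom-drop1 (runs (concat rs)) ih

headsFrom-≤ : ∀ {b z} rs → All IsRun rs → HeadsFrom b rs → z ∈ concat rs → b ≤ z
headsFrom-≤ ((a ∷ v) ∷ rs) (run inc ∷ rs-runs) (b≤a ∷ sorted) z∈ with ∈-++⁻ (a ∷ v) z∈
... | inj₁ z∈r  = ≤-trans b≤a (increasing-head≤ inc z∈r)
... | inj₂ z∈rs = ≤-trans b≤a (headsFrom-≤ rs rs-runs sorted z∈rs)

≥-headsFrom : ∀ {b z ρ} → HeadsFrom b (runs ρ) → z ∈ ρ → b ≤ z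
≥-headsFrom {ρ = ρ} sorted z∈ρ =
  headsFrom-≤ (runs ρ) (runs-isRun ρ) sorted (subst (_ ∈_) (sym (concat-runs ρ)) z∈ρ)

-- Run-sorting; RSP(n) as the run-sorted permutations of [n]

headsFrom-insertRun : ∀ {b} r rs → HeadsFrom b rs → b ≤ headOr0 r → HeadsFrom b (insertRun r rs)
headsFrom-insertRun r []       _               b≤r = b≤r ∷ [-]
headsFrom-insertRun r (s ∷ rs) (b≤s ∷ sorted) b≤r
  with headOr0 s <ᵇ headOr0 r | <ᵇ-reflects-< (headOr0 s) (headOr0 r)
... | true  | ofʸ s<r = b≤s ∷ headsFrom-insertRun r rs sorted (<⇒≤ s<r)
... | false | ofⁿ s≮r = b≤r ∷ ≮⇒≥ s≮r ∷ sorted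

headsFrom-sortRuns : ∀ rs → HeadsFrom 0 (sortRuns rs)
headsFrom-sortRuns []       = [-]
headsFrom-sortRuns (r ∷ rs) = headsFrom-insertRun r (sortRuns rs) (headsFrom-sortRuns rs) z≤n

All-insertRun : ∀ {P : List ℕ → Set} r rs → P r → All P rs → All P (insertRun r rs)
All-insertRun r []       pr _          = pr ∷ []
All-insertRun r (s ∷ rs) pr (ps ∷ prs) with headOr0 s <ᵇ headOr0 r
... | true  = ps ∷ All-insertRun r rs pr prs
... | false = pr ∷ ps ∷ prs

All-sortRuns : ∀ {P : List ℕ → Set} rs → All P rs → All P (sortRuns rs)
All-sortRuns []       _          = []
All-sortRuns (r ∷ rs) (pr ∷ prs) = All-insertRun r (sortRuns rs) pr (All-sortRuns rs prs)

runSorted-runsort : ∀ σ → RunSorted (runsort σ)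
runSorted-runsort σ =
  headsFrom-concat (sortRuns (runs σ)) (All-sortRuns (runs σ) (runs-isRun σ)) (headsFrom-sortRuns (runs σ))

insertRun-headsFrom : ∀ r rs → HeadsFrom (headOr0 r) rs → insertRun r rs ≡ r ∷ rs
insertRun-headsFrom r []       _           = refl
insertRun-headsFrom r (s ∷ rs) (r≤s ∷ _) rewrite <ᵇ-false {headOr0 s} {headOr0 r} r≤s = refl

sortRuns-headsFrom : ∀ {b} rs → HeadsFrom b rs → sortRuns rs ≡ rs
sortRuns-headsFrom []       _              = refl
sortRuns-headsFrom (r ∷ rs) (_ ∷ sorted) rewrite sortRuns-headsFrom rs sorted = insertRun-headsFrom r rs sorted

runsort-runSorted : ∀ {π} → RunSorted π → runsort π ≡ π
runsort-runSorted {π} sorted rewrite sortRuns-headsFrom (runs π) sorted = concat-runs π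

concat-insertRun : ∀ r rs → concat (insertRun r rs) ↭ r ++ concat rs
concat-insertRun r []       = ↭-refl
concat-insertRun r (s ∷ rs) with headOr0 s <ᵇ headOr0 r
... | true  = ↭-trans (++⁺ˡ s (concat-insertRun r rs))
                (subst₂ _↭_ (List.++-assoc s r (concat rs)) (List.++-assoc r s (concat rs))
                  (++⁺ʳ (concat rs) (++-comm s r)))
... | false = ↭-refl

concat-sortRuns : ∀ rs → concat (sortRuns rs) ↭ concat rs
concat-sortRuns []       = ↭-refl
concat-sortRuns (r ∷ rs) = ↭-trans (concat-insertRun r (sortRuns rs)) (++⁺ˡ r (concat-sortRuns rs))

runsort-↭ : ∀ σ → runsort σ ↭ σ
runsort-↭ σ = subst (runsort σ ↭_) (concat-runs σ) (concat-sortRuns (runs σ))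

insertAll-↭ : ∀ x ys {σ} → σ ∈ insertAll x ys → σ ↭ x ∷ ys
insertAll-↭ x []       (here refl) = ↭-refl
insertAll-↭ x (y ∷ ys) (here refl) = ↭-refl
insertAll-↭ x (y ∷ ys) (there σ∈) with ∈-map⁻ (y ∷_) σ∈
... | τ , τ∈ , refl = ↭-trans (prep y (insertAll-↭ x ys τ∈)) (swap y x ↭-refl)

perms-↭ : ∀ xs {σ} → σ ∈ perms xs → σ ↭ xs
perms-↭ []       (here refl) = ↭-refl
perms-↭ (x ∷ xs) σ∈ with ∈-concatMap-∃ (insertAll x) (perms xs) σ∈
... | τ , τ∈ , σ∈τ = ↭-trans (insertAll-↭ x τ σ∈τ) (prep x (perms-↭ xs τ∈))

∈-insertAll : ∀ x σ₁ σ₂ → σ₁ ++ x ∷ σ₂ ∈ insertAll x (σ₁ ++ σ₂)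
∈-insertAll x []       []       = here refl
∈-insertAll x []       (y ∷ σ₂) = here refl
∈-insertAll x (y ∷ σ₁) σ₂       = there (∈-map⁺ (y ∷_) (∈-insertAll x σ₁ σ₂))

↭-∈-perms : ∀ xs {σ} → σ ↭ xs → σ ∈ perms xs
↭-∈-perms []       p rewrite ↭-empty-inv p = here refl
↭-∈-perms (x ∷ xs) p with ∈-∃++ (∈-resp-↭ (↭-sym p) (here refl))
... | σ₁ , σ₂ , refl =
  ∈-concatMap-intro (insertAll x) (↭-∈-perms xs (↭-sym (drop-mid [] σ₁ (↭-sym p))))
    (∈-insertAll x σ₁ σ₂)

∈-RSP⁻ : ∀ n {π} → π ∈ RSP n → π ↭ range1 n × RunSorted π
∈-RSP⁻ n π∈ with ∈-map⁻ runsort (∈-deduplicate⁻ (List.≡-dec _≟_) _ π∈)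
... | σ , σ∈ , refl = ↭-trans (runsort-↭ σ) (perms-↭ (range1 n) σ∈) , runSorted-runsort σ

∈-RSP⁺ : ∀ n {π} → π ↭ range1 n → RunSorted π → π ∈ RSP n
∈-RSP⁺ n {π} p sorted = ∈-deduplicate⁺ (List.≡-dec _≟_)
  (subst (_∈ map runsort (Sym n)) (runsort-runSorted sorted) (∈-map⁺ runsort (↭-∈-perms (range1 n) p)))

-- Splitting a list into two complementary subsequences

consˡ consʳ : ℕ → List ℕ × List ℕ → List ℕ × List ℕ
consˡ a (S , K) = a ∷ S , K
consʳ a (S , K) = S , a ∷ K

branch : ℕ → List (List ℕ × List ℕ) → List (List ℕ × List ℕ) → List (List ℕ × List ℕ)
branch a X Y = map (consˡ a) X ++ map (consʳ a) Y

splits : List ℕ → List (List ℕ × List ℕ)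
splits []      = ([] , []) ∷ []
splits (a ∷ l) = branch a (splits l) (splits l)

rightNonemptySplits : List ℕ → List (List ℕ × List ℕ)
rightNonemptySplits []      = []
rightNonemptySplits (a ∷ l) = branch a (rightNonemptySplits l) (splits l)

-- For increasing l these are the splits (S , K) with S, K nonempty and
-- head S < last K; the recursion uses that the head of l is its minimum.
descentSplits : List ℕ → List (List ℕ × List ℕ)
descentSplits []      = []
descentSplits (a ∷ l) = branch a (rightNonemptySplits l) (descentSplits l)

∈-branch⁻ : ∀ a X Y {p} → p ∈ branch a X Y →
  (∃ λ q → q ∈ X × p ≡ consˡ a q) ⊎ (∃ λ q → q ∈ Y × p ≡ consʳ a q)
∈-branch⁻ a X Y p∈ with ∈-++⁻ (map (consˡ a) X) p∈
... | inj₁ p∈X = inj₁ (∈-map⁻ (consˡ a) p∈X)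
... | inj₂ p∈Y = inj₂ (∈-map⁻ (consʳ a) p∈Y)

∈-branchˡ : ∀ a X Y {q} → q ∈ X → consˡ a q ∈ branch a X Y
∈-branchˡ a X Y q∈ = ∈-++⁺ˡ (∈-map⁺ (consˡ a) q∈)

∈-branchʳ : ∀ a X Y {q} → q ∈ Y → consʳ a q ∈ branch a X Y
∈-branchʳ a X Y q∈ = ∈-++⁺ʳ (map (consˡ a) X) (∈-map⁺ (consʳ a) q∈)

rightNonemptySplits⊆splits : ∀ l {p} → p ∈ rightNonemptySplits l → p ∈ splits l
rightNonemptySplits⊆splits (a ∷ l) p∈ with ∈-branch⁻ a (rightNonemptySplits l) (splits l) p∈
... | inj₁ (q , q∈ , refl) = ∈-branchˡ a (splits l) (splits l) (rightNonemptySplits⊆splits l q∈)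
... | inj₂ (q , q∈ , refl) = ∈-branchʳ a (splits l) (splits l) q∈

descentSplits⊆splits : ∀ l {p} → p ∈ descentSplits l → p ∈ splits l
descentSplits⊆splits (a ∷ l) p∈ with ∈-branch⁻ a (rightNonemptySplits l) (descentSplits l) p∈
... | inj₁ (q , q∈ , refl) = ∈-branchˡ a (splits l) (splits l) (rightNonemptySplits⊆splits l q∈)
... | inj₂ (q , q∈ , refl) = ∈-branchʳ a (splits l) (splits l) (descentSplits⊆splits l q∈)

splits-↭ : ∀ l {p} → p ∈ splits l → proj₁ p ++ proj₂ p ↭ l
splits-↭ []      (here refl) = ↭-refl
splits-↭ (a ∷ l) p∈ with ∈-branch⁻ a (splits l) (splits l) p∈
... | inj₁ (q , q∈ , refl) = prep a (splits-↭ l q∈)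
... | inj₂ (q , q∈ , refl) = ↭-trans (shift a (proj₁ q) (proj₂ q)) (prep a (splits-↭ l q∈))

splits-∈₁ : ∀ l {p z} → p ∈ splits l → z ∈ proj₁ p → z ∈ l
splits-∈₁ l p∈ z∈ = ∈-resp-↭ (splits-↭ l p∈) (∈-++⁺ˡ z∈)

splits-∈₂ : ∀ l {p z} → p ∈ splits l → z ∈ proj₂ p → z ∈ l
splits-∈₂ l {p} p∈ z∈ = ∈-resp-↭ (splits-↭ l p∈) (∈-++⁺ʳ (proj₁ p) z∈)

splits-complement-↭ : ∀ l {S K ρ} → (S , K) ∈ splits l → K ++ ρ ↭ l → ρ ↭ S
splits-complement-↭ l {S} {K} S∈ p = ++-cancelˡ-↭ K (↭-trans p (↭-trans (↭-sym (splits-↭ l S∈)) (++-comm S K)))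

splits-length : ∀ l {p} → p ∈ splits l → length (proj₁ p) + length (proj₂ p) ≡ length l
splits-length l {p} p∈ = trans (sym (List.length-++ (proj₁ p))) (↭-length (splits-↭ l p∈))

increasing-∷ : ∀ {a l} → All (a <_) l → Increasing l → Increasing (a ∷ l)
increasing-∷ []          []  = [-]
increasing-∷ (a<b ∷ _) inc = a<b ∷ inc

increasing-∷-⊆ : ∀ {a l S} → Increasing (a ∷ l) → (∀ {z} → z ∈ S → z ∈ l) → Increasing S → Increasing (a ∷ S)
increasing-∷-⊆ inc S⊆l = increasing-∷ (All.tabulate (λ z∈ → All.lookup (increasing-head< inc) (S⊆l z∈)))

splits-increasing : ∀ l {p} → Increasing l → p ∈ splits l → Increasing (proj₁ p) × Increasing (proj₂ p)
splits-increasing []      _   (here refl) = [] , []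
splits-increasing (a ∷ l) inc p∈ with ∈-branch⁻ a (splits l) (splits l) p∈
... | inj₁ (q , q∈ , refl) =
  increasing-∷-⊆ inc (splits-∈₁ l q∈) (proj₁ ih) , proj₂ ih
  where
  ih : Increasing (proj₁ q) × Increasing (proj₂ q)
  ih = splits-increasing l (Linked.tail inc) q∈
... | inj₂ (q , q∈ , refl) =
  proj₁ ih , increasing-∷-⊆ inc (splits-∈₂ l q∈) (proj₂ ih)
  where
  ih : Increasing (proj₁ q) × Increasing (proj₂ q)
  ih = splits-increasing l (Linked.tail inc) q∈

data DescentSplit : List ℕ × List ℕ → Set where
  descentSplit : ∀ {s S c K} → s < lastOf c K → DescentSplit (s ∷ S , c ∷ K)

rightNonemptySplits-nonempty : ∀ l {p} → p ∈ rightNonemptySplits l → ∃ λ c → ∃ λ K → proj₂ p ≡ c ∷ K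
rightNonemptySplits-nonempty (a ∷ l) p∈ with ∈-branch⁻ a (rightNonemptySplits l) (splits l) p∈
... | inj₁ (q , q∈ , refl) = rightNonemptySplits-nonempty l q∈
... | inj₂ (q , q∈ , refl) = a , proj₂ q , refl

descentSplits-descent : ∀ l {p} → Increasing l → p ∈ descentSplits l → DescentSplit p
descentSplits-descent (a ∷ l) inc p∈ with ∈-branch⁻ a (rightNonemptySplits l) (descentSplits l) p∈
... | inj₁ (q , q∈ , refl) with rightNonemptySplits-nonempty l q∈
...   | c , K , e rewrite e = descentSplit (All.lookup (increasing-head< inc) last∈l)
  where
  last∈l : lastOf c K ∈ l
  last∈l = splits-∈₂ l (rightNonemptySplits⊆splits l q∈) (subst (lastOf c K ∈_) (sym e) (lastOf-∈ c K))
descentSplits-descent (a ∷ l) inc p∈ | inj₂ (q , q∈ , refl)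
  with descentSplits-descent l (Linked.tail inc) q∈
... | descentSplit s<last = descentSplit s<last

sublist-∈-splits : ∀ l K → Increasing l → Increasing K → (∀ {z} → z ∈ K → z ∈ l) →
  ∃ λ S → (S , K) ∈ splits l
sublist-∈-splits []      []      _   _    _   = [] , here refl
sublist-∈-splits []      (c ∷ K) _   _    K⊆l with K⊆l (here refl)
... | ()
sublist-∈-splits (t ∷ l) []      inc _    _   with sublist-∈-splits l [] (Linked.tail inc) [] (λ ())
... | S , S∈ = t ∷ S , ∈-branchˡ t (splits l) (splits l) S∈
sublist-∈-splits (t ∷ l) (c ∷ K) inc incK K⊆l with c ≟ t
... | yes refl with sublist-∈-splits l K (Linked.tail inc) (Linked.tail incK) K⊆l′
  where
  K⊆l′ : ∀ {z} → z ∈ K → z ∈ l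
  K⊆l′ z∈ = ∈-∷-≢ (K⊆l (there z∈)) (≢-sym (<⇒≢ (All.lookup (increasing-head< incK) z∈)))
...   | S , S∈ = S , ∈-branchʳ t (splits l) (splits l) S∈
sublist-∈-splits (t ∷ l) (c ∷ K) inc incK K⊆l | no c≢t
  with sublist-∈-splits l (c ∷ K) (Linked.tail inc) incK cK⊆l
  where
  t<c : t < c
  t<c = All.lookup (increasing-head< inc) (∈-∷-≢ (K⊆l (here refl)) c≢t)
  cK⊆l : ∀ {z} → z ∈ c ∷ K → z ∈ l
  cK⊆l z∈ = ∈-∷-≢ (K⊆l z∈) (≢-sym (<⇒≢ (<-≤-trans t<c (increasing-head≤ incK z∈))))
... | S , S∈ = t ∷ S , ∈-branchˡ t (splits l) (splits l) S∈

∈-rightNonemptySplits : ∀ l {S c K} → (S , c ∷ K) ∈ splits l → (S , c ∷ K) ∈ rightNonemptySplits l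
∈-rightNonemptySplits []      (here ())
∈-rightNonemptySplits []      (there ())
∈-rightNonemptySplits (a ∷ l) p∈ with ∈-branch⁻ a (splits l) (splits l) p∈
... | inj₁ (q , q∈ , refl) = ∈-branchˡ a (rightNonemptySplits l) (splits l) (∈-rightNonemptySplits l q∈)
... | inj₂ (q , q∈ , refl) = ∈-branchʳ a (rightNonemptySplits l) (splits l) q∈

∈-descentSplits : ∀ l {s S c K} → Increasing l → (s ∷ S , c ∷ K) ∈ splits l → s < lastOf c K →
  (s ∷ S , c ∷ K) ∈ descentSplits l
∈-descentSplits []      _   (here ())
∈-descentSplits []      _   (there ())
∈-descentSplits (a ∷ l) inc p∈ s<last with ∈-branch⁻ a (splits l) (splits l) p∈
... | inj₁ (q , q∈ , refl) = ∈-branchˡ a (rightNonemptySplits l) (descentSplits l) (∈-rightNonemptySplits l q∈)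
∈-descentSplits (a ∷ l) {s} {K = []} inc p∈ s<a | inj₂ (q , q∈ , refl) =
  ⊥-elim (<-asym s<a (All.lookup (increasing-head< inc) (splits-∈₁ l q∈ (here refl))))
∈-descentSplits (a ∷ l) {K = c ∷ K} inc p∈ s<last | inj₂ (q , q∈ , refl) =
  ∈-branchʳ a (rightNonemptySplits l) (descentSplits l) (∈-descentSplits l (Linked.tail inc) q∈ s<last)

rights : List (List ℕ × List ℕ) → List (List ℕ)
rights = map proj₂

rights-unique-branch : ∀ a X Y → Unique (rights X) → Unique (rights Y) →
  (∀ {q} → q ∈ X → a ∉ proj₂ q) → Unique (rights (branch a X Y))
rights-unique-branch a X Y uX uY a∉X = subst Unique (sym rights-++)
  (Unique.++⁺ uX (Unique.map⁺ List.∷-injectiveʳ uY) disjoint)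
  where
  rights-++ : rights (branch a X Y) ≡ rights X ++ map (a ∷_) (rights Y)
  rights-++ = trans (List.map-++ proj₂ (map (consˡ a) X) (map (consʳ a) Y))
    (cong₂ _++_ (sym (List.map-∘ X)) (trans (sym (List.map-∘ Y)) (List.map-∘ Y)))
  disjoint : ∀ {K} → ¬ (K ∈ rights X × K ∈ map (a ∷_) (rights Y))
  disjoint (K∈X , K∈Y) with ∈-map⁻ (a ∷_) K∈Y
  ... | _ , _ , refl with ∈-map⁻ proj₂ K∈X
  ...   | q , q∈ , e = a∉X q∈ (subst (a ∈_) e (here refl))

splits-rights-unique : ∀ l → Increasing l → Unique (rights (splits l))
splits-rights-unique []      _   = [] ∷ []
splits-rights-unique (a ∷ l) inc = rights-unique-branch a (splits l) (splits l) ih ih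
  (λ q∈ a∈ → increasing-head∉ inc (splits-∈₂ l q∈ a∈))
  where
  ih : Unique (rights (splits l))
  ih = splits-rights-unique l (Linked.tail inc)

rightNonemptySplits-rights-unique : ∀ l → Increasing l → Unique (rights (rightNonemptySplits l))
rightNonemptySplits-rights-unique []      _   = []
rightNonemptySplits-rights-unique (a ∷ l) inc = rights-unique-branch a (rightNonemptySplits l) (splits l)
  (rightNonemptySplits-rights-unique l (Linked.tail inc)) (splits-rights-unique l (Linked.tail inc))
  (λ q∈ a∈ → increasing-head∉ inc (splits-∈₂ l (rightNonemptySplits⊆splits l q∈) a∈))

descentSplits-rights-unique : ∀ l → Increasing l → Unique (rights (descentSplits l))
descentSplits-rights-unique []      _   = []
descentSplits-rights-unique (a ∷ l) inc = rights-unique-branch a (rightNonemptySplits l) (descentSplits l)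
  (rightNonemptySplits-rights-unique l (Linked.tail inc)) (descentSplits-rights-unique l (Linked.tail inc))
  (λ q∈ a∈ → increasing-head∉ inc (splits-∈₂ l (rightNonemptySplits⊆splits l q∈) a∈))

-- The run-sorted permutations of an increasing list

firstRun : ∀ a L → ∃ λ v → ∃ λ ρ → L ≡ v ++ ρ × Increasing (a ∷ v) × lastOf a v ≥Head ρ
firstRun a []      = [] , [] , refl , [-] , tt
firstRun a (b ∷ L) with a <? b
... | yes a<b = let v , ρ , L≡ , inc , ρ≤ = firstRun b L in b ∷ v , ρ , cong (b ∷_) L≡ , a<b ∷ inc , ρ≤
... | no  a≮b = [] , b ∷ L , refl , [-] , ≮⇒≥ a≮b

runSorted-head≤ : ∀ {a L z} → RunSorted (a ∷ L) → z ∈ a ∷ L → a ≤ z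
runSorted-head≤ {a} {L} sorted = ≥-headsFrom {ρ = a ∷ L} (runSorted-lower {ρ = L} ≤-refl sorted)

runSorted-↭-head : ∀ {a L m Ts} → Increasing (m ∷ Ts) → a ∷ L ↭ m ∷ Ts → RunSorted (a ∷ L) → a ≡ m
runSorted-↭-head {L = L} inc p sorted = ≤-antisym
  (runSorted-head≤ {L = L} sorted (∈-resp-↭ (↭-sym p) (here refl)))
  (increasing-head≤ inc (∈-resp-↭ p (here refl)))

data Descends (c : ℕ) : List ℕ → Set where
  descends : ∀ {s ρ} → s < c → Descends c (s ∷ ρ)

descends⇒≥Head : ∀ {c ρ} → Descends c ρ → c ≥Head ρ
descends⇒≥Head (descends s<c) = <⇒≤ s<c

-- The fuel f is a termination measure only: the list is complete once
-- f ≥ length Ts.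
runSortedPerms : ℕ → List ℕ → List (List ℕ)
withFirstRun : ℕ → ℕ → List ℕ × List ℕ → List (List ℕ)

runSortedPerms f       []       = [] ∷ []
runSortedPerms zero    (m ∷ Ts) = (m ∷ Ts) ∷ []
runSortedPerms (suc f) (m ∷ Ts) = (m ∷ Ts) ∷ concatMap (withFirstRun f m) (descentSplits Ts)

withFirstRun f m (S , K) = map (λ ρ → m ∷ K ++ ρ) (runSortedPerms f S)

runSortedPerms-self : ∀ f m Ts → m ∷ Ts ∈ runSortedPerms f (m ∷ Ts)
runSortedPerms-self zero    m Ts = here refl
runSortedPerms-self (suc f) m Ts = here refl

descentSplits-increasing : ∀ {m Ts p} → Increasing (m ∷ Ts) → p ∈ descentSplits Ts →
  Increasing (m ∷ proj₁ p) × Increasing (m ∷ proj₂ p)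
descentSplits-increasing {Ts = Ts} {p} inc p∈ =
  increasing-∷-⊆ inc (splits-∈₁ Ts p∈splits) (proj₁ incSK) , increasing-∷-⊆ inc (splits-∈₂ Ts p∈splits) (proj₂ incSK)
  where
  p∈splits : p ∈ splits Ts
  p∈splits = descentSplits⊆splits Ts p∈
  incSK : Increasing (proj₁ p) × Increasing (proj₂ p)
  incSK = splits-increasing Ts (Linked.tail inc) p∈splits

descentSplit-join : ∀ {m Ts p ρ} → Increasing (m ∷ Ts) → p ∈ descentSplits Ts →
  ρ ↭ proj₁ p → RunSorted ρ →
  Increasing (m ∷ proj₂ p) × Descends (lastOf m (proj₂ p)) ρ × HeadsFrom m (runs ρ)
descentSplit-join {Ts = Ts} inc p∈ ρ↭ sorted with descentSplits-descent Ts (Linked.tail inc) p∈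
descentSplit-join {ρ = []}    inc p∈ ρ↭ sorted | descentSplit _ with ↭-length ρ↭
... | ()
descentSplit-join {ρ = b ∷ ρ} inc p∈ ρ↭ sorted | descentSplit s<last
  with mS , incS ← descentSplits-increasing inc p∈ | runSorted-↭-head {L = ρ} (Linked.tail mS) ρ↭ sorted
... | refl = incS , descends s<last , runSorted-lower {ρ = ρ} (<⇒≤ (Linked.head mS)) sorted

runSortedPerms-sound : ∀ f {Ts π} → Increasing Ts → π ∈ runSortedPerms f Ts → π ↭ Ts × RunSorted π
runSortedPerms-sound f       {[]}     _   (here refl) = ↭-refl , [-]
runSortedPerms-sound zero    {m ∷ Ts} inc (here refl) = ↭-refl , runSorted-increasing inc
runSortedPerms-sound (suc f) {m ∷ Ts} inc (here refl) = ↭-refl , runSorted-increasing inc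
runSortedPerms-sound (suc f) {m ∷ Ts} inc (there π∈) with ∈-concatMap-∃ (withFirstRun f m) (descentSplits Ts) π∈
... | (S , K) , p∈ , π∈p with ∈-map⁻ (λ ρ → m ∷ K ++ ρ) π∈p
... | ρ , ρ∈ , refl
  with ρ↭ , ρ-sorted ← runSortedPerms-sound f (Linked.tail (proj₁ (descentSplits-increasing inc p∈))) ρ∈
  with incK , desc , ρ-headsFrom ← descentSplit-join inc p∈ ρ↭ ρ-sorted =
  prep m (↭-trans (++⁺ˡ K ρ↭) (↭-trans (++-comm K S) (splits-↭ Ts (descentSplits⊆splits Ts p∈)))) ,
  subst (HeadsFrom 0) (sym (runs-++ m K ρ incK (descends⇒≥Head desc))) (z≤n ∷ ρ-headsFrom)

runSortedPerms-complete : ∀ f {Ts π} → Increasing Ts → length Ts ≤ f → π ↭ Ts → RunSorted π →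
  π ∈ runSortedPerms f Ts

-- v is nonempty, and (Ts minus v , v) is a descent split of Ts.
withFirstRun-complete : ∀ f {m Ts v b ρ} → Increasing (m ∷ Ts) → length Ts ≤ f →
  m ∷ v ++ b ∷ ρ ↭ m ∷ Ts → Increasing (m ∷ v) → b ≤ lastOf m v → HeadsFrom m (runs (b ∷ ρ)) →
  m ∷ v ++ b ∷ ρ ∈ runSortedPerms (suc f) (m ∷ Ts)
withFirstRun-complete f {m} {v = []} {b} {ρ} inc _ p _ b≤m ρ-headsFrom with ↭-increasing⇒unique p inc
... | m∉ ∷ _ =
  ⊥-elim (All.lookup m∉ (here refl) (≤-antisym (≥-headsFrom {ρ = b ∷ ρ} ρ-headsFrom (here refl)) b≤m))
withFirstRun-complete f {m} {Ts} {c ∷ v} {b} {ρ} inc len p incv b≤last ρ-headsFrom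
  with sublist-∈-splits Ts (c ∷ v) (Linked.tail inc) (Linked.tail incv) v⊆Ts
  where
  v⊆Ts : ∀ {z} → z ∈ c ∷ v → z ∈ Ts
  v⊆Ts z∈ =
    ∈-∷-≢ (∈-resp-↭ p (there (∈-++⁺ˡ z∈))) (≢-sym (<⇒≢ (All.lookup (increasing-head< incv) z∈)))
... | [] , S∈ with ↭-length (splits-complement-↭ Ts S∈ (drop-∷ p))
...   | ()
withFirstRun-complete f {m} {Ts} {c ∷ v} {b} {ρ} inc len p incv b≤last ρ-headsFrom | s ∷ S , S∈ =
  there (∈-concatMap-intro (withFirstRun f m) p∈ (∈-map⁺ (λ ρ → m ∷ (c ∷ v) ++ ρ) ρ∈))
  where
  incS : Increasing (s ∷ S)
  incS = proj₁ (splits-increasing Ts (Linked.tail inc) S∈)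
  ρ↭S : b ∷ ρ ↭ s ∷ S
  ρ↭S = splits-complement-↭ Ts S∈ (drop-∷ p)
  ρ-sorted : RunSorted (b ∷ ρ)
  ρ-sorted = headsFrom-lower (runs (b ∷ ρ)) z≤n ρ-headsFrom
  |S|≤f : length (s ∷ S) ≤ f
  |S|≤f = ≤-trans (m≤m+n (length (s ∷ S)) (length (c ∷ v))) (≤-trans (≤-reflexive (splits-length Ts S∈)) len)
  ρ∈ : b ∷ ρ ∈ runSortedPerms f (s ∷ S)
  ρ∈ = runSortedPerms-complete f incS |S|≤f ρ↭S ρ-sorted
  unique-vρ : Unique ((c ∷ v) ++ b ∷ ρ)
  unique-vρ with ↭-increasing⇒unique p inc
  ... | _ ∷ u = u
  b<last : b < lastOf c v
  b<last = ≤∧≢⇒< b≤last (λ b≡last →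
    unique-++-∉ (c ∷ v) unique-vρ (subst (_∈ c ∷ v) (sym b≡last) (lastOf-∈ c v)) (here refl))
  p∈ : (s ∷ S , c ∷ v) ∈ descentSplits Ts
  p∈ = ∈-descentSplits Ts (Linked.tail inc) S∈
    (subst (_< lastOf c v) (runSorted-↭-head {L = ρ} incS ρ↭S ρ-sorted) b<last)

runSortedPerms-complete f    {[]}     _ _ p _ rewrite ↭-empty-inv p = here refl
runSortedPerms-complete zero {_ ∷ _}  _ () _ _
runSortedPerms-complete f    {m ∷ Ts} {[]} _ _ p _ with ↭-length p
... | ()
runSortedPerms-complete (suc f) {m ∷ Ts} {a ∷ L} inc len p sorted
  with refl ← runSorted-↭-head {L = L} inc p sorted
  with firstRun a L
... | v , [] , refl , incv , _ =
  subst (_∈ runSortedPerms (suc f) (m ∷ Ts))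
    (sym (increasing-↭⇒≡ (subst (λ u → Increasing (m ∷ u)) (sym (List.++-identityʳ v)) incv) inc p))
    (runSortedPerms-self (suc f) m Ts)
... | v , b ∷ ρ , refl , incv , b≤last =
  withFirstRun-complete f inc (s≤s⁻¹ len) p incv b≤last (runSorted-++ incv b≤last sorted)

withFirstRun-join : ∀ f {m Ts p ρ} → Increasing (m ∷ Ts) → p ∈ descentSplits Ts →
  ρ ∈ runSortedPerms f (proj₁ p) →
  Increasing (m ∷ proj₂ p) × Descends (lastOf m (proj₂ p)) ρ × length ρ ≡ length (proj₁ p)
withFirstRun-join f inc p∈ ρ∈
  with ρ↭ , ρ-sorted ← runSortedPerms-sound f (Linked.tail (proj₁ (descentSplits-increasing inc p∈))) ρ∈
  with incK , desc , _ ← descentSplit-join inc p∈ ρ↭ ρ-sorted = incK , desc , ↭-length ρ↭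

headRun : List (List ℕ) → List ℕ
headRun []      = []
headRun (r ∷ _) = r

withFirstRun-headRun : ∀ f {m Ts p π} → Increasing (m ∷ Ts) → p ∈ descentSplits Ts →
  π ∈ withFirstRun f m p →
  headRun (runs π) ≡ m ∷ proj₂ p
withFirstRun-headRun f {m} {p = S , K} inc p∈ π∈ with ∈-map⁻ (λ ρ → m ∷ K ++ ρ) π∈
... | ρ , ρ∈ , refl with incK , desc , _ ← withFirstRun-join f inc p∈ ρ∈ =
  cong headRun (runs-++ m K ρ incK (descends⇒≥Head desc))

runSortedPerms-unique : ∀ f {Ts} → Increasing Ts → Unique (runSortedPerms f Ts)
runSortedPerms-unique f       {[]}     _   = [] ∷ []
runSortedPerms-unique zero    {m ∷ Ts} _   = [] ∷ []
runSortedPerms-unique (suc f) {m ∷ Ts} inc =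
  All.tabulate self∉ ∷
  concatMap-unique (withFirstRun f m) (headRun ∘ runs) ((m ∷_) ∘ proj₂) (descentSplits Ts)
    (subst Unique (sym (List.map-∘ {g = m ∷_} {f = proj₂} (descentSplits Ts)))
      (Unique.map⁺ List.∷-injectiveʳ (descentSplits-rights-unique Ts (Linked.tail inc))))
    (λ p∈ → Unique.map⁺ (List.++-cancelˡ (m ∷ _) _ _)
      (runSortedPerms-unique f (Linked.tail (proj₁ (descentSplits-increasing inc p∈)))))
    (withFirstRun-headRun f inc)
  where
  self∉ : ∀ {π} → π ∈ concatMap (withFirstRun f m) (descentSplits Ts) → m ∷ Ts ≢ π
  self∉ π∈ refl with ∈-concatMap-∃ (withFirstRun f m) (descentSplits Ts) π∈
  ... | p , p∈ , π∈p with descentSplits-descent Ts (Linked.tail inc) p∈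
  ... | descentSplit _ = m≢1+n+m (length Ts) (trans (sym (splits-length Ts (descentSplits⊆splits Ts p∈)))
          (cong (λ K → length (proj₁ p) + length K) (sym Ts≡K)))
    where
    Ts≡K : Ts ≡ proj₂ p
    Ts≡K = List.∷-injectiveʳ (trans (sym (cong headRun (runs-increasing inc))) (withFirstRun-headRun f inc p∈ π∈p))

RSP↭runSortedPerms : ∀ n → RSP n ↭ runSortedPerms n (range1 n)
RSP↭runSortedPerms n = ∼bag⇒↭ (unique∧set⇒bag
  (deduplicate-! (map runsort (Sym n))) (runSortedPerms-unique n (increasing-range1 n))
  (mk⇔ (λ π∈ → let p , sorted = ∈-RSP⁻ n π∈ in
                runSortedPerms-complete n (increasing-range1 n) (≤-reflexive (length-range1 n)) p sorted)
       (λ π∈ → let p , sorted = runSortedPerms-sound n (increasing-range1 n) π∈ in ∈-RSP⁺ n p sorted)))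

-- Counting descent splits by size

δ : ℕ → ℕ → ℕ
δ i j = if i ≡ᵇ j then 1 else 0

δ-refl : ∀ i → δ i i ≡ 1
δ-refl i with i ≡ᵇ i | ≡⇒≡ᵇ i i refl
... | true | _ = refl

δ-≢ : ∀ {i j} → i ≢ j → δ i j ≡ 0
δ-≢ {i} {j} i≢j with i ≡ᵇ j | ≡ᵇ⇒≡ i j
... | false | _   = refl
... | true  | i≡j = ⊥-elim (i≢j (i≡j tt))

multiplicity : ℕ → List ℕ → ℕ
multiplicity i []       = 0
multiplicity i (j ∷ js) = δ i j + multiplicity i js

multiplicity-++ : ∀ i xs ys → multiplicity i (xs ++ ys) ≡ multiplicity i xs + multiplicity i ys
multiplicity-++ i []       ys = refl
multiplicity-++ i (j ∷ xs) ys = trans (cong (δ i j +_) (multiplicity-++ i xs ys)) (sym (+-assoc (δ i j) _ _))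

multiplicity-0-map-suc : ∀ xs → multiplicity 0 (map suc xs) ≡ 0
multiplicity-0-map-suc []       = refl
multiplicity-0-map-suc (x ∷ xs) = multiplicity-0-map-suc xs

multiplicity-suc-map-suc : ∀ i xs → multiplicity (suc i) (map suc xs) ≡ multiplicity i xs
multiplicity-suc-map-suc i []       = refl
multiplicity-suc-map-suc i (x ∷ xs) = cong (δ i x +_) (multiplicity-suc-map-suc i xs)

range1-suc : ∀ n → range1 (suc n) ≡ 1 ∷ map suc (range1 n)
range1-suc n = cong (λ l → 1 ∷ map suc l) (sym (List.map-upTo suc n))

multiplicity-range1 : ∀ {n j} → 1 ≤ j → j ≤ n → multiplicity j (range1 n) ≡ 1
multiplicity-range1 {suc n} {1} _ _ =
  trans (cong (multiplicity 1) (range1-suc n))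
    (cong suc (trans (multiplicity-suc-map-suc 0 (range1 n)) (multiplicity-0-map-suc (upTo n))))
multiplicity-range1 {suc n} {suc (suc j)} _ (s≤s j<n) =
  trans (cong (multiplicity (suc (suc j))) (range1-suc n))
    (trans (multiplicity-suc-map-suc (suc j) (range1 n)) (multiplicity-range1 (s≤s z≤n) j<n))

sizes : List (List ℕ × List ℕ) → List ℕ
sizes = map (length ∘ proj₁)

sizes-branch : ∀ a X Y → sizes (branch a X Y) ≡ map suc (sizes X) ++ sizes Y
sizes-branch a X Y = trans (List.map-++ _ (map (consˡ a) X) (map (consʳ a) Y))
  (cong₂ _++_ (trans (sym (List.map-∘ X)) (List.map-∘ X)) (sym (List.map-∘ Y)))

multiplicity-0-branch : ∀ a X Y → multiplicity 0 (sizes (branch a X Y)) ≡ multiplicity 0 (sizes Y)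
multiplicity-0-branch a X Y rewrite sizes-branch a X Y
  | multiplicity-++ 0 (map suc (sizes X)) (sizes Y) | multiplicity-0-map-suc (sizes X) = refl

multiplicity-suc-branch : ∀ i a X Y →
  multiplicity (suc i) (sizes (branch a X Y)) ≡ multiplicity i (sizes X) + multiplicity (suc i) (sizes Y)
multiplicity-suc-branch i a X Y rewrite sizes-branch a X Y
  | multiplicity-++ (suc i) (map suc (sizes X)) (sizes Y) | multiplicity-suc-map-suc i (sizes X) = refl

1≤nCk : ∀ {n k} → k ≤ n → 1 ≤ n C k
1≤nCk {n}     {zero}  _         = ≤-refl
1≤nCk {suc n} {suc k} (s≤s k≤n) =
  subst (1 ≤_) (nCk+nC[k+1]≡[n+1]C[k+1] n k) (≤-trans (1≤nCk k≤n) (m≤m+n _ _))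

pascal-∸1 : ∀ k {i} → i ∈ range1 k → suc k C i ∸ 1 ≡ (k C i ∸ 1) + k C (i ∸ 1)
pascal-∸1 k i∈ with ∈-map⁻ suc i∈
... | j , j∈ , refl = begin
  suc k C suc j ∸ 1        ≡⟨ cong (_∸ 1) (sym (nCk+nC[k+1]≡[n+1]C[k+1] k j)) ⟩
  (k C j + k C suc j) ∸ 1  ≡⟨ cong (_∸ 1) (+-comm (k C j) (k C suc j)) ⟩
  (k C suc j + k C j) ∸ 1  ≡⟨ +-∸-comm (k C j) (1≤nCk (∈-upTo⁻ j∈)) ⟩
  (k C suc j ∸ 1) + k C j  ∎
  where open ≡-Reasoning

splits-count : ∀ l i → multiplicity i (sizes (splits l)) ≡ length l C i
splits-count []      zero    = refl
splits-count []      (suc i) = refl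
splits-count (a ∷ l) zero    = trans (multiplicity-0-branch a (splits l) (splits l)) (splits-count l 0)
splits-count (a ∷ l) (suc i) = begin
  multiplicity (suc i) (sizes (branch a (splits l) (splits l)))
    ≡⟨ multiplicity-suc-branch i a (splits l) (splits l) ⟩
  multiplicity i (sizes (splits l)) + multiplicity (suc i) (sizes (splits l))
    ≡⟨ cong₂ _+_ (splits-count l i) (splits-count l (suc i)) ⟩
  length l C i + length l C suc i
    ≡⟨ nCk+nC[k+1]≡[n+1]C[k+1] (length l) i ⟩
  suc (length l) C suc i ∎
  where open ≡-Reasoning

-- Only the split (l , []) is missing.
rightNonemptySplits-count : ∀ l i → multiplicity i (sizes (rightNonemptySplits l)) ≡ length l C i ∸ δ i (length l)
rightNonemptySplits-count []      zero    = refl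
rightNonemptySplits-count []      (suc i) = refl
rightNonemptySplits-count (a ∷ l) zero    =
  trans (multiplicity-0-branch a (rightNonemptySplits l) (splits l)) (splits-count l 0)
rightNonemptySplits-count (a ∷ l) (suc i) =
  trans (multiplicity-suc-branch i a (rightNonemptySplits l) (splits l))
    (trans (cong₂ _+_ (rightNonemptySplits-count l i) (splits-count l (suc i))) (pascal-∸δ (length l)))
  where
  pascal-∸δ : ∀ k → (k C i ∸ δ i k) + k C suc i ≡ suc k C suc i ∸ δ i k
  pascal-∸δ k with <-cmp i k
  ... | tri< i<k i≢k _ rewrite δ-≢ i≢k = nCk+nC[k+1]≡[n+1]C[k+1] k i
  ... | tri≈ _ refl _ rewrite δ-refl i | nCn≡1 i | nCn≡1 (suc i) | k>n⇒nCk≡0 (n<1+n i) = refl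
  ... | tri> _ i≢k k<i
    rewrite δ-≢ i≢k | k>n⇒nCk≡0 k<i | k>n⇒nCk≡0 (m<n⇒m<1+n k<i) | k>n⇒nCk≡0 (s≤s k<i) = refl

descentSplits-count : ∀ l i → multiplicity i (sizes (descentSplits l)) ≡ length l C i ∸ 1
descentSplits-count []      zero    = refl
descentSplits-count []      (suc i) = refl
descentSplits-count (a ∷ l) zero    =
  trans (multiplicity-0-branch a (rightNonemptySplits l) (descentSplits l)) (descentSplits-count l 0)
descentSplits-count (a ∷ l) (suc i) =
  trans (multiplicity-suc-branch i a (rightNonemptySplits l) (descentSplits l))
    (trans (cong₂ _+_ (rightNonemptySplits-count l i) (descentSplits-count l (suc i))) (pascal-∸δ∸1 (length l)))
  where
  pascal-∸δ∸1 : ∀ k → (k C i ∸ δ i k) + (k C suc i ∸ 1) ≡ suc k C suc i ∸ 1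
  pascal-∸δ∸1 k with <-cmp i k
  ... | tri< i<k i≢k _ rewrite δ-≢ i≢k =
    trans (sym (+-∸-assoc (k C i) (1≤nCk i<k))) (cong (_∸ 1) (nCk+nC[k+1]≡[n+1]C[k+1] k i))
  ... | tri≈ _ refl _ rewrite δ-refl i | nCn≡1 i | nCn≡1 (suc i) | k>n⇒nCk≡0 (n<1+n i) = refl
  ... | tri> _ i≢k k<i
    rewrite δ-≢ i≢k | k>n⇒nCk≡0 k<i | k>n⇒nCk≡0 (m<n⇒m<1+n k<i) | k>n⇒nCk≡0 (s≤s k<i) = refl

descentSplits-sizes : ∀ l → Increasing l → All (λ i → 1 ≤ i × i ≤ length l ∸ 1) (sizes (descentSplits l))
descentSplits-sizes l inc = All.map⁺ (All.tabulate bounds)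
  where
  bounds : ∀ {p} → p ∈ descentSplits l → 1 ≤ length (proj₁ p) × length (proj₁ p) ≤ length l ∸ 1
  bounds {p} p∈ with descentSplits-descent l inc p∈
  ... | descentSplit {S = S} {K = K} _ = s≤s z≤n ,
    subst (λ n → suc (length S) ≤ n ∸ 1) (splits-length l (descentSplits⊆splits l p∈))
      (subst (suc (length S) ≤_) (sym (+-suc (length S) (length K))) (s≤s (m≤m+n (length S) (length K))))

module Sums {c ℓ} (R : CommutativeSemiring c ℓ) where
  open CommutativeSemiring R
    using (Carrier; _≈_; 0#; 1#; isEquivalence; +-isCommutativeMonoid; zeroʳ; distribˡ)
    renaming (_+_ to _⊕_; _*_ to _⊗_; setoid to ≈-setoid; refl to ≈-refl; sym to ≈-sym; trans to ≈-trans;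
              +-assoc to ⊕-assoc; +-comm to ⊕-comm; +-identityˡ to ⊕-identityˡ; +-identityʳ to ⊕-identityʳ;
              +-cong to ⊕-cong; +-congˡ to ⊕-congˡ)
  open import Relation.Binary.Reasoning.Setoid ≈-setoid

  ∑ : List Carrier → Carrier
  ∑ = Σ[_] R

  infixr 8 _•_
  _•_ : ℕ → Carrier → Carrier
  _•_ = _·_ R

  ∑-cong : ∀ {A : Set} {f g : A → Carrier} xs → (∀ {a} → a ∈ xs → f a ≈ g a) →
    ∑ (map f xs) ≈ ∑ (map g xs)
  ∑-cong []       _   = ≈-refl
  ∑-cong (a ∷ xs) f≈g = ⊕-cong (f≈g (here refl)) (∑-cong xs (f≈g ∘ there))

  ∑-++ : ∀ xs ys → ∑ (xs ++ ys) ≈ ∑ xs ⊕ ∑ ys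
  ∑-++ []       ys = ≈-sym (⊕-identityˡ (∑ ys))
  ∑-++ (a ∷ xs) ys = ≈-trans (⊕-congˡ (∑-++ xs ys)) (≈-sym (⊕-assoc a (∑ xs) (∑ ys)))

  ∑-↭ : ∀ {A : Set} (f : A → Carrier) {xs ys} → xs ↭ ys → ∑ (map f xs) ≈ ∑ (map f ys)
  ∑-↭ f p =
    Permutationₛ.foldr-commMonoid ≈-setoid +-isCommutativeMonoid (↭⇒↭ₛ′ isEquivalence (↭-map⁺ f p))

  ∑-concatMap : ∀ {A B : Set} (f : B → Carrier) (g : A → List B) xs →
    ∑ (map f (concatMap g xs)) ≈ ∑ (map (λ a → ∑ (map f (g a))) xs)
  ∑-concatMap f g []       = ≈-refl
  ∑-concatMap f g (a ∷ xs) = begin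
    ∑ (map f (g a ++ concatMap g xs))              ≡⟨ cong ∑ (List.map-++ f (g a) (concatMap g xs)) ⟩
    ∑ (map f (g a) ++ map f (concatMap g xs))      ≈⟨ ∑-++ (map f (g a)) (map f (concatMap g xs)) ⟩
    ∑ (map f (g a)) ⊕ ∑ (map f (concatMap g xs))   ≈⟨ ⊕-congˡ (∑-concatMap f g xs) ⟩
    ∑ (map (λ a → ∑ (map f (g a))) (a ∷ xs))       ∎

  ∑-*ˡ : ∀ {A : Set} a (f : A → Carrier) xs → ∑ (map (λ z → a ⊗ f z) xs) ≈ a ⊗ ∑ (map f xs)
  ∑-*ˡ a f []       = ≈-sym (zeroʳ a)
  ∑-*ˡ a f (z ∷ xs) = ≈-trans (⊕-congˡ (∑-*ˡ a f xs)) (≈-sym (distribˡ a (f z) (∑ (map f xs))))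

  ∑-+ : ∀ {A : Set} (f g : A → Carrier) xs →
    ∑ (map (λ a → f a ⊕ g a) xs) ≈ ∑ (map f xs) ⊕ ∑ (map g xs)
  ∑-+ f g []       = ≈-sym (⊕-identityˡ 0#)
  ∑-+ f g (a ∷ xs) = begin
    (f a ⊕ g a) ⊕ ∑ (map (λ a → f a ⊕ g a) xs)   ≈⟨ ⊕-congˡ (∑-+ f g xs) ⟩
    (f a ⊕ g a) ⊕ (F ⊕ G)                         ≈⟨ ⊕-assoc (f a) (g a) (F ⊕ G) ⟩
    f a ⊕ (g a ⊕ (F ⊕ G))                         ≈⟨ ⊕-congˡ (≈-sym (⊕-assoc (g a) F G)) ⟩
    f a ⊕ ((g a ⊕ F) ⊕ G)                         ≈⟨ ⊕-congˡ (⊕-cong (⊕-comm (g a) F) ≈-refl) ⟩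
    f a ⊕ ((F ⊕ g a) ⊕ G)                         ≈⟨ ⊕-congˡ (⊕-assoc F (g a) G) ⟩
    f a ⊕ (F ⊕ (g a ⊕ G))                         ≈⟨ ≈-sym (⊕-assoc (f a) F (g a ⊕ G)) ⟩
    (f a ⊕ F) ⊕ (g a ⊕ G)                         ∎
    where
    F G : Carrier
    F = ∑ (map f xs)
    G = ∑ (map g xs)

  •-distribʳ : ∀ m n a → (m + n) • a ≈ m • a ⊕ n • a
  •-distribʳ zero    n a = ≈-sym (⊕-identityˡ (n • a))
  •-distribʳ (suc m) n a = ≈-trans (⊕-congˡ (•-distribʳ m n a)) (≈-sym (⊕-assoc a (m • a) (n • a)))

  •-congˡ : ∀ k {a b} → a ≈ b → k • a ≈ k • b
  •-congˡ zero    _   = ≈-refl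
  •-congˡ (suc k) a≈b = ⊕-cong a≈b (•-congˡ k a≈b)

  ∑-δ : ∀ (h : ℕ → Carrier) j xs → ∑ (map (λ i → δ i j • h i) xs) ≈ multiplicity j xs • h j
  ∑-δ h j []       = ≈-refl
  ∑-δ h j (i ∷ xs) with i ≟ j
  ... | yes refl = ≈-trans (⊕-congˡ (∑-δ h i xs)) (≈-sym (•-distribʳ (δ i i) (multiplicity i xs) (h i)))
  ... | no  i≢j rewrite δ-≢ i≢j | δ-≢ (≢-sym i≢j) = ≈-trans (⊕-congˡ (∑-δ h j xs)) (⊕-identityˡ _)

  ∑-multiplicity : ∀ N (h : ℕ → Carrier) ns → All (λ j → 1 ≤ j × j ≤ N) ns →
    ∑ (map h ns) ≈ Σ1 R N (λ i → multiplicity i ns • h i)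
  ∑-multiplicity N h []       _                    = ≈-sym (∑-zero (range1 N))
    where
    ∑-zero : ∀ is → ∑ (map (λ i → 0 • h i) is) ≈ 0#
    ∑-zero []       = ≈-refl
    ∑-zero (_ ∷ is) = ≈-trans (⊕-identityˡ _) (∑-zero is)
  ∑-multiplicity N h (j ∷ js) ((1≤j , j≤N) ∷ bounds) = begin
    h j ⊕ ∑ (map h js)
      ≈⟨ ⊕-cong (≈-sym (⊕-identityʳ (h j))) (∑-multiplicity N h js bounds) ⟩
    1 • h j ⊕ Σ1 R N (λ i → multiplicity i js • h i)
      ≡⟨ cong (λ k → k • h j ⊕ _) (sym (multiplicity-range1 1≤j j≤N)) ⟩
    multiplicity j (range1 N) • h j ⊕ Σ1 R N (λ i → multiplicity i js • h i)
      ≈⟨ ⊕-cong (≈-sym (∑-δ h j (range1 N))) ≈-refl ⟩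
    Σ1 R N (λ i → δ i j • h i) ⊕ Σ1 R N (λ i → multiplicity i js • h i)
      ≈⟨ ≈-sym (∑-+ (λ i → δ i j • h i) (λ i → multiplicity i js • h i) (range1 N)) ⟩
    ∑ (map (λ i → δ i j • h i ⊕ multiplicity i js • h i) (range1 N))
      ≈⟨ ∑-cong (range1 N) (λ {i} _ → ≈-sym (•-distribʳ (δ i j) (multiplicity i js) (h i))) ⟩
    Σ1 R N (λ i → multiplicity i (j ∷ js) • h i) ∎

-- Descent weights and the recurrences

module Recurrence {c ℓ} (R : CommutativeSemiring c ℓ) (x : ℕ → CommutativeSemiring.Carrier R) where
  open CommutativeSemiring R
    using (Carrier; _≈_; 1#; *-cong; *-congˡ; *-identityˡ)
    renaming (_+_ to _⊕_; _*_ to _⊗_; setoid to ≈-setoid; refl to ≈-refl; sym to ≈-sym; trans to ≈-trans;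
              reflexive to ≈-reflexive; +-assoc to ⊕-assoc; +-cong to ⊕-cong; +-congˡ to ⊕-congˡ)
  open Sums R
  open import Relation.Binary.Reasoning.Setoid ≈-setoid

  -- A descent at position j of a word of length n is followed by n - j
  -- entries, so it contributes x (n - j), as in A.
  weight : List ℕ → Carrier
  weight []          = 1#
  weight (a ∷ [])    = 1#
  weight (a ∷ b ∷ ρ) = (if b <ᵇ a then x (length (b ∷ ρ)) else 1#) ⊗ weight (b ∷ ρ)

  Π-desFrom≈weight : ∀ n k π → suc n ≡ k + length π →
    Π[_] R (map (λ j → x (n ∸ j)) (desFrom k π)) ≈ weight π
  Π-desFrom≈weight n k []          _ = ≈-refl
  Π-desFrom≈weight n k (a ∷ [])    _ = ≈-refl
  Π-desFrom≈weight n k (a ∷ b ∷ ρ) e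
    with b <ᵇ a | Π-desFrom≈weight n (suc k) (b ∷ ρ) (trans e (+-suc k (length (b ∷ ρ))))
  ... | true  | ih = *-cong (≈-reflexive (cong x (∸-offset k e))) ih
  ... | false | ih = ≈-trans ih (≈-sym (*-identityˡ (weight (b ∷ ρ))))

  weight-increasing : ∀ {l} → Increasing l → weight l ≈ 1#
  weight-increasing []                      = ≈-refl
  weight-increasing [-]                     = ≈-refl
  weight-increasing (_∷_ {x = a} {y = b} a<b inc) rewrite <ᵇ-false {b} {a} (<⇒≤ a<b) =
    ≈-trans (*-identityˡ _) (weight-increasing inc)

  weight-withFirstRun : ∀ m K {ρ} → Increasing (m ∷ K) → Descends (lastOf m K) ρ →
    weight (m ∷ K ++ ρ) ≈ x (length ρ) ⊗ weight ρ
  weight-withFirstRun m []      [-]         (descends s<m) rewrite <ᵇ-true s<m = ≈-refl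
  weight-withFirstRun m (c ∷ K) (m<c ∷ inc) desc rewrite <ᵇ-false {c} {m} (<⇒≤ m<c) =
    ≈-trans (*-identityˡ _) (weight-withFirstRun c K inc desc)

  weightSum : ℕ → List ℕ → Carrier
  weightSum f Ts = ∑ (map weight (runSortedPerms f Ts))

  weightSum-∷ : ∀ f {m Ts} → Increasing (m ∷ Ts) →
    weightSum (suc f) (m ∷ Ts) ≈
    1# ⊕ ∑ (map (λ p → x (length (proj₁ p)) ⊗ weightSum f (proj₁ p)) (descentSplits Ts))
  weightSum-∷ f {m} {Ts} inc = ⊕-cong (weight-increasing inc) (begin
    ∑ (map weight (concatMap (withFirstRun f m) (descentSplits Ts)))
      ≈⟨ ∑-concatMap weight (withFirstRun f m) (descentSplits Ts) ⟩
    ∑ (map (λ p → ∑ (map weight (withFirstRun f m p))) (descentSplits Ts))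
      ≈⟨ ∑-cong (descentSplits Ts) block ⟩
    ∑ (map (λ p → x (length (proj₁ p)) ⊗ weightSum f (proj₁ p)) (descentSplits Ts)) ∎)
    where
    block : ∀ {p} → p ∈ descentSplits Ts →
      ∑ (map weight (withFirstRun f m p)) ≈ x (length (proj₁ p)) ⊗ weightSum f (proj₁ p)
    block {S , K} p∈ = begin
      ∑ (map weight (map (λ ρ → m ∷ K ++ ρ) (runSortedPerms f S)))
        ≡⟨ cong ∑ (sym (List.map-∘ (runSortedPerms f S))) ⟩
      ∑ (map (λ ρ → weight (m ∷ K ++ ρ)) (runSortedPerms f S))
        ≈⟨ ∑-cong (runSortedPerms f S) weight-ρ ⟩
      ∑ (map (λ ρ → x (length S) ⊗ weight ρ) (runSortedPerms f S))
        ≈⟨ ∑-*ˡ (x (length S)) weight (runSortedPerms f S) ⟩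
      x (length S) ⊗ weightSum f S ∎
      where
      weight-ρ : ∀ {ρ} → ρ ∈ runSortedPerms f S → weight (m ∷ K ++ ρ) ≈ x (length S) ⊗ weight ρ
      weight-ρ ρ∈ with incK , desc , |ρ|≡|S| ← withFirstRun-join f inc p∈ ρ∈ =
        ≈-trans (weight-withFirstRun m K incK desc) (*-cong (≈-reflexive (cong x |ρ|≡|S|)) ≈-refl)

  V : ℕ → Carrier
  V n = weightSum n (range1 n)

  SizeInvariant : ℕ → Set ℓ
  SizeInvariant k = ∀ f {Ts} → Increasing Ts → length Ts ≡ k → k ≤ f → weightSum f Ts ≈ V k

  weightSum-recurrence : ∀ N k f {m Ts} → (∀ {j} → j < suc k → SizeInvariant j) →
    Increasing (m ∷ Ts) → length Ts ≡ k → k ≤ f → k ∸ 1 ≤ N →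
    weightSum (suc f) (m ∷ Ts) ≈ 1# ⊕ Σ1 R N (λ i → (k C i ∸ 1) • (x i ⊗ V i))
  weightSum-recurrence N k f {m} {Ts} invariant inc refl k≤f k∸1≤N =
    ≈-trans (weightSum-∷ f inc) (⊕-congˡ (begin
    ∑ (map (λ p → x (length (proj₁ p)) ⊗ weightSum f (proj₁ p)) (descentSplits Ts))
      ≈⟨ ∑-cong (descentSplits Ts) inner ⟩
    ∑ (map (y ∘ length ∘ proj₁) (descentSplits Ts))
      ≡⟨ cong ∑ (List.map-∘ (descentSplits Ts)) ⟩
    ∑ (map y (sizes (descentSplits Ts)))
      ≈⟨ ∑-multiplicity N y (sizes (descentSplits Ts))
           (All.map (λ (1≤i , i≤) → 1≤i , ≤-trans i≤ k∸1≤N) (descentSplits-sizes Ts (Linked.tail inc))) ⟩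
    Σ1 R N (λ i → multiplicity i (sizes (descentSplits Ts)) • y i)
      ≡⟨ cong ∑ (List.map-cong (λ i → cong (_• y i) (descentSplits-count Ts i)) (range1 N)) ⟩
    Σ1 R N (λ i → (k C i ∸ 1) • y i) ∎))
    where
    y : ℕ → Carrier
    y i = x i ⊗ V i
    inner : ∀ {p} → p ∈ descentSplits Ts → x (length (proj₁ p)) ⊗ weightSum f (proj₁ p) ≈ y (length (proj₁ p))
    inner {p} p∈ = *-congˡ
      (invariant (s≤s |S|≤) f (proj₁ (splits-increasing Ts (Linked.tail inc) p∈splits)) refl (≤-trans |S|≤ k≤f))
      where
      p∈splits : p ∈ splits Ts
      p∈splits = descentSplits⊆splits Ts p∈
      |S|≤ : length (proj₁ p) ≤ length Ts
      |S|≤ = ≤-trans (m≤m+n _ _) (≤-reflexive (splits-length Ts p∈splits))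

  sizeInvariant : ∀ k → SizeInvariant k
  sizeInvariant = <-rec SizeInvariant invariant
    where
    invariant : ∀ k → (∀ {j} → j < k → SizeInvariant j) → SizeInvariant k
    invariant zero    _  f       {[]}     _   _   _         = ≈-refl
    invariant (suc k) ih (suc f) {m ∷ Ts} inc len (s≤s k≤f) =
      ≈-trans (weightSum-recurrence k k f ih inc (suc-injective len) k≤f (m∸n≤m k 1))
        (≈-sym (weightSum-recurrence k k k ih (increasing-range1 (suc k)) (suc-injective (length-range1 (suc k)))
                  ≤-refl (m∸n≤m k 1)))

  A≈V : ∀ n → A R x n ≈ V n
  A≈V n = begin
    A R x n                 ≈⟨ ∑-cong (RSP n) (λ {π} π∈ → Π-desFrom≈weight n 1 π (cong suc (sym (|π|≡n π∈)))) ⟩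
    ∑ (map weight (RSP n))  ≈⟨ ∑-↭ weight (RSP↭runSortedPerms n) ⟩
    V n                     ∎
    where
    |π|≡n : ∀ {π} → π ∈ RSP n → length π ≡ n
    |π|≡n π∈ = trans (↭-length (proj₁ (∈-RSP⁻ n π∈))) (length-range1 n)

  -- Any upper bound N ≥ k - 1 of summation may be used, as the sizes of
  -- descent splits stay below k; A-pascal needs N = k.
  A-recurrence : ∀ N k → k ∸ 1 ≤ N → A R x (suc k) ≈ 1# ⊕ Σ1 R N (λ i → (k C i ∸ 1) • (x i ⊗ A R x i))
  A-recurrence N k k∸1≤N = begin
    A R x (suc k)
      ≈⟨ A≈V (suc k) ⟩
    V (suc k)
      ≈⟨ weightSum-recurrence N k k (λ _ → sizeInvariant _) (increasing-range1 (suc k))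
           (suc-injective (length-range1 (suc k))) ≤-refl k∸1≤N ⟩
    1# ⊕ Σ1 R N (λ i → (k C i ∸ 1) • (x i ⊗ V i))
      ≈⟨ ⊕-congˡ (∑-cong (range1 N) (λ {i} _ → •-congˡ (k C i ∸ 1) (*-congˡ (≈-sym (A≈V i))))) ⟩
    1# ⊕ Σ1 R N (λ i → (k C i ∸ 1) • (x i ⊗ A R x i)) ∎

  A-pascal : ∀ k → A R x (suc (suc k)) ≈ A R x (suc k) ⊕ Σ1 R k (λ i → (k C (i ∸ 1)) • (x i ⊗ A R x i))
  A-pascal k = begin
    A R x (suc (suc k))
      ≈⟨ A-recurrence k (suc k) ≤-refl ⟩
    1# ⊕ Σ1 R k (λ i → (suc k C i ∸ 1) • Y i)
      ≈⟨ ⊕-congˡ (∑-cong (range1 k) split) ⟩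
    1# ⊕ ∑ (map (λ i → (k C i ∸ 1) • Y i ⊕ (k C (i ∸ 1)) • Y i) (range1 k))
      ≈⟨ ⊕-congˡ (∑-+ (λ i → (k C i ∸ 1) • Y i) (λ i → (k C (i ∸ 1)) • Y i) (range1 k)) ⟩
    1# ⊕ (Σ1 R k (λ i → (k C i ∸ 1) • Y i) ⊕ Σ1 R k (λ i → (k C (i ∸ 1)) • Y i))
      ≈⟨ ≈-sym (⊕-assoc 1# _ _) ⟩
    (1# ⊕ Σ1 R k (λ i → (k C i ∸ 1) • Y i)) ⊕ Σ1 R k (λ i → (k C (i ∸ 1)) • Y i)
      ≈⟨ ⊕-cong (≈-sym (A-recurrence k k (m∸n≤m k 1))) ≈-refl ⟩
    A R x (suc k) ⊕ Σ1 R k (λ i → (k C (i ∸ 1)) • Y i) ∎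
    where
    Y : ℕ → Carrier
    Y i = x i ⊗ A R x i
    split : ∀ {i} → i ∈ range1 k → (suc k C i ∸ 1) • Y i ≈ (k C i ∸ 1) • Y i ⊕ (k C (i ∸ 1)) • Y i
    split {i} i∈ =
      ≈-trans (≈-reflexive (cong (_• Y i) (pascal-∸1 k i∈))) (•-distribʳ (k C i ∸ 1) (k C (i ∸ 1)) (Y i))

theorem3p1 : ∀ {c ℓ} (R : CommutativeSemiring c ℓ) (x : ℕ → CommutativeSemiring.Carrier R) →
    ((n : ℕ) → 1 ≤ n →
      CommutativeSemiring._≈_ R (A R x n)
        (CommutativeSemiring._+_ R (CommutativeSemiring.1# R)
          (Σ1 R (n ∸ 2) (λ i → _·_ R (((n ∸ 1) C i) ∸ 1) (CommutativeSemiring._*_ R (x i) (A R x i))))))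
    × ((n : ℕ) → 2 ≤ n →
      CommutativeSemiring._≈_ R (A R x n)
        (CommutativeSemiring._+_ R (A R x (n ∸ 1))
          (Σ1 R (n ∸ 2) (λ i → _·_ R ((n ∸ 2) C (i ∸ 1)) (CommutativeSemiring._*_ R (x i) (A R x i))))))
theorem3p1 R x =
  (λ { (suc k) _ → A-recurrence (k ∸ 1) k ≤-refl }) ,
  (λ { (suc zero) (s≤s ()) ; (suc (suc k)) _ → A-pascal k })
  where open Recurrence R x
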